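{- For every integer $j\ge0$, $L(j,j)=\dfrac{a_{j+1}-a_j}{\Lambda-1}$.
   Context: Fix nonnegative integers $\lambda_1,\lambda_2,\dots$ and an integer $k\ge1$ (the order) such that $\lambda_1\ge1$, $\lambda_k\ge1$, $\lambda_i=0$ for $i>k$, and $\lambda_1\ge2$ if $k=1$. Define $(a_n)_{n\in\mathbb Z}$ by $a_n=1$ for $n\le0$ and $a_n=\sum_{i=1}^k\lambda_ia_{n-i}$ for $n\ge1$. Let $\Lambda_j=\sum_{i=1}^j\lambda_i$ and $\Lambda=\Lambda_k$. Finite ordered trees $T_j$: $T_0$ is a single node; for $j\ge1$, $T_j$ has a chain of special nodes $s_j$ (root), $s_{j-1},\dots,s_0$ with $s_i$ on level $i$ and $s_{i-1}$ the leftmost child of $s_i$, and $s_i$ ($1\le i\le j$) has $\Lambda_{j-i+1}$ children: $s_{i-1}$ followed by $\Lambda_{j-i+1}-1$ roots of copies of $T_{i-1}$. For $0\le t\le j$, $L(j,t)$ denotes the number of leaves of $T_j$ that descend from (or equal) its special node $s_t$ on level $t$; in particular $L(j,j)$ is the number of leaves of $T_j$. -}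

module Defs where

open import Data.Nat using (ℕ; zero; suc; _+_; _*_; _∸_)
open import Data.List using (List; []; _∷_; replicate)

-- The coefficients are given as a function  lam : ℕ → ℕ  with  lam i = λ_i  for i ≥ 1
-- (the value  lam 0  is never used).

Lam : (ℕ → ℕ) → ℕ → ℕ
Lam lam zero    = 0
Lam lam (suc j) = Lam lam j + lam (suc j)

sum1 : ℕ → (ℕ → ℕ) → ℕ
sum1 zero    f = 0
sum1 (suc m) f = sum1 m f + f (suc m)

-- window lam k n m = a_{n - m}  (an integer index, possibly ≤ 0) for n, m ∈ ℕ.
-- window _ _ 0 m = a_{-m} = 1;  a_{n+1} = Σ_{i=1}^{k} λ_i a_{n+1-i} = Σ λ_i · window n (i-1).
window : (ℕ → ℕ) → ℕ → ℕ → ℕ → ℕ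
window lam k zero    m       = 1
window lam k (suc n) zero    = sum1 k (λ i → lam i * window lam k n (i ∸ 1))
window lam k (suc n) (suc m) = window lam k n m

a : (ℕ → ℕ) → ℕ → ℕ → ℕ
a lam k n = window lam k n 0

data Tree : Set where
  node : List Tree → Tree

mutual
  leaves : Tree → ℕ
  leaves (node []) = 1
  leaves (node (t ∷ ts)) = leaves t + leavesList ts

  leavesList : List Tree → ℕ
  leavesList []       = 0
  leavesList (t ∷ ts) = leaves t + leavesList ts

mutual
  T : (ℕ → ℕ) → ℕ → Tree
  T lam j = S lam j j

  -- S lam j i = the subtree of T_j rooted at the special node s_i (for i ≤ j).
  -- s_0 is a leaf; s_{i+1} has Λ_{j-i} children: s_i followed by Λ_{j-i} - 1 copies of T_i.
  S : (ℕ → ℕ) → ℕ → ℕ → Tree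
  S lam j zero    = node []
  S lam j (suc i) = node (S lam j i ∷ replicate (Lam lam (j ∸ i) ∸ 1) (T lam i))

L : (ℕ → ℕ) → ℕ → ℕ → ℕ
L lam j t = leaves (S lam j t)

-- Unfolding the tree, the special node s_{t+1} of T_j has Λ_{j-t} children: s_t and
-- Λ_{j-t} - 1 copies of T_t, so  L(j,t+1) = L(j,t) + (Λ_{j-t} - 1) L(t,t)  and L(j,0) = 1.
-- By strong induction on j assume (Λ - 1) L(t,t) = a_{t+1} - a_t for t < j.  Then the
-- quantity (Λ - 1) L(j,t) + a_t equals  R(j,t) = Σ_i λ_i a_{min(t, j+1-i)}  for all t ≤ j:
-- both sides are Λ at t = 0, and passing from t to t+1 adds Λ_{j-t} (a_{t+1} - a_t) to each,
-- since min(t, j+1-i) grows exactly for the Λ_{j-t}-weighted indices i ≤ j - t.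
-- At t = j the sum R(j,j) is the recurrence for a_{j+1}.
module Submission where

open import Defs
open import Data.Nat using (ℕ; _≤_; _<_)
open import Relation.Binary.PropositionalEquality using (_≡_)

module LeafCount where

  open import Data.Nat using (zero; suc; _+_; _*_; _∸_; _⊓_; z≤n; s≤s)
  open import Data.Nat.Properties
  open import Data.Nat.Induction using (<-rec)
  open import Algebra.Properties.CommutativeSemigroup +-commutativeSemigroup using (xy∙z≈xz∙y)
  open import Data.Nat.Tactic.RingSolver using (solve-∀)
  open import Data.List using (replicate)
  open import Data.Sum using (inj₁; inj₂)
  import Data.Integer as ℤ
  open import Data.Integer using (+_; _⊖_)
  open import Data.Integer.Properties using ([+m]-[+n]≡m⊖n; ⊖-≥; pos-*)
  open import Relation.Binary.PropositionalEquality
    using (refl; sym; trans; cong; cong₂; subst; module ≡-Reasoning)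

  window≡a : ∀ lam k n m → window lam k n m ≡ a lam k (n ∸ m)
  window≡a lam k zero    zero    = refl
  window≡a lam k zero    (suc m) = refl
  window≡a lam k (suc n) zero    = refl
  window≡a lam k (suc n) (suc m) = window≡a lam k n m

  sum1-cong : ∀ m {f g : ℕ → ℕ} → (∀ i → f (suc i) ≡ g (suc i)) → sum1 m f ≡ sum1 m g
  sum1-cong zero    f≗g = refl
  sum1-cong (suc m) f≗g = cong₂ _+_ (sum1-cong m f≗g) (f≗g m)

  a-suc : ∀ lam k n → a lam k (suc n) ≡ sum1 k (λ i → lam i * a lam k (n ∸ (i ∸ 1)))
  a-suc lam k n = sum1-cong k λ i → cong (lam (suc i) *_) (window≡a lam k n i)

  sum1-vanishing : ∀ k {f : ℕ → ℕ} → (∀ i → k < i → f i ≡ 0) → ∀ n → sum1 (k + n) f ≡ sum1 k f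
  sum1-vanishing k {f} f≡0 zero    = cong (λ m → sum1 m f) (+-identityʳ k)
  sum1-vanishing k {f} f≡0 (suc n) = begin
    sum1 (k + suc n) f                ≡⟨ cong (λ m → sum1 m f) (+-suc k n) ⟩
    sum1 (k + n) f + f (suc (k + n))  ≡⟨ cong₂ _+_ (sum1-vanishing k f≡0 n) (f≡0 _ (s≤s (m≤m+n k n))) ⟩
    sum1 k f + 0                      ≡⟨ +-identityʳ _ ⟩
    sum1 k f                          ∎
    where open ≡-Reasoning

  m≤n∸o⇒1+o≤1+n∸m : ∀ {m n o} → o ≤ n → m ≤ n ∸ o → suc o ≤ suc n ∸ m
  m≤n∸o⇒1+o≤1+n∸m {m} {n} {o} o≤n m≤n∸o =
    m+n≤o⇒m≤o∸n (suc o) (s≤s (subst (_≤ n) (+-comm m o) (m≤o∸n⇒m+n≤o m o≤n m≤n∸o)))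

  n∸o<m⇒1+n∸m≤o : ∀ {m n o} → n ∸ o < m → suc n ∸ m ≤ o
  n∸o<m⇒1+n∸m≤o {m} {n} {o} n∸o<m = m≤n+o⇒m∸n≤o (suc n) m (begin
    suc n            ≤⟨ s≤s (m≤n+m∸n n o) ⟩
    suc (o + (n ∸ o)) ≡⟨ +-suc o (n ∸ o) ⟨
    o + suc (n ∸ o)  ≤⟨ +-monoʳ-≤ o n∸o<m ⟩
    o + m            ≡⟨ +-comm o m ⟩
    m + o            ∎)
    where open ≤-Reasoning

  module _ (lam : ℕ → ℕ) where

    sum1-*-const : ∀ m c → sum1 m (λ i → lam i * c) ≡ Lam lam m * c
    sum1-*-const zero    c = refl
    sum1-*-const (suc m) c = trans (cong (_+ lam (suc m) * c) (sum1-*-const m c))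
                                   (sym (*-distribʳ-+ c (Lam lam m) (lam (suc m))))

    Lam-pos : 1 ≤ lam 1 → ∀ {m} → 1 ≤ m → 1 ≤ Lam lam m
    Lam-pos λ₁≥1 {suc zero}    _ = λ₁≥1
    Lam-pos λ₁≥1 {suc (suc m)} _ =
      ≤-trans (Lam-pos λ₁≥1 (s≤s z≤n)) (m≤m+n (Lam lam (suc m)) (lam (suc (suc m))))

    sum1-*-+-const : ∀ K {F G : ℕ → ℕ} D → (∀ i → i ≤ K → F i ≡ G i + D)
      → sum1 K (λ i → lam i * F i) ≡ sum1 K (λ i → lam i * G i) + Lam lam K * D
    sum1-*-+-const zero    D F≡G+D = refl
    sum1-*-+-const (suc K) {F} {G} D F≡G+D = begin
      sum1 K (λ i → lam i * F i) + l * F (suc K)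
        ≡⟨ cong₂ (λ s x → s + l * x) (sum1-*-+-const K D λ i i≤K → F≡G+D i (m≤n⇒m≤1+n i≤K))
                                     (F≡G+D (suc K) ≤-refl) ⟩
      (sum1 K (λ i → lam i * G i) + Lam lam K * D) + l * (G (suc K) + D)
        ≡⟨ regroup (sum1 K (λ i → lam i * G i)) (Lam lam K) l (G (suc K)) D ⟩
      (sum1 K (λ i → lam i * G i) + l * G (suc K)) + (Lam lam K + l) * D  ∎
      where
      open ≡-Reasoning
      l = lam (suc K)
      regroup : ∀ s Λ l g d → (s + Λ * d) + l * (g + d) ≡ (s + l * g) + (Λ + l) * d
      regroup = solve-∀

    sum1-*-+-const-prefix : ∀ K m {F G : ℕ → ℕ} D → m ≤ K
      → (∀ i → i ≤ m → F i ≡ G i + D) → (∀ i → m < i → F i ≡ G i)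
      → sum1 K (λ i → lam i * F i) ≡ sum1 K (λ i → lam i * G i) + Lam lam m * D
    sum1-*-+-const-prefix K m D m≤K F≡G+D F≡G with m≤n⇒m<n∨m≡n m≤K
    ... | inj₂ refl = sum1-*-+-const K D F≡G+D
    sum1-*-+-const-prefix (suc K) m {F} {G} D _ F≡G+D F≡G | inj₁ (s≤s m≤K) = begin
      sum1 K (λ i → lam i * F i) + l * F (suc K)
        ≡⟨ cong₂ (λ s x → s + l * x) (sum1-*-+-const-prefix K m D m≤K F≡G+D F≡G)
                                     (F≡G (suc K) (s≤s m≤K)) ⟩
      (sum1 K (λ i → lam i * G i) + Lam lam m * D) + l * G (suc K)
        ≡⟨ xy∙z≈xz∙y (sum1 K (λ i → lam i * G i)) (Lam lam m * D) (l * G (suc K)) ⟩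
      (sum1 K (λ i → lam i * G i) + l * G (suc K)) + Lam lam m * D  ∎
      where
      open ≡-Reasoning
      l = lam (suc K)

    leavesList-replicate : ∀ c t → leavesList (replicate c t) ≡ c * leaves t
    leavesList-replicate zero    t = refl
    leavesList-replicate (suc c) t = cong (λ n → leaves t + n) (leavesList-replicate c t)

    L-suc : 1 ≤ lam 1 → ∀ {j t} → t < j
      → L lam j (suc t) + L lam t t ≡ L lam j t + Lam lam (j ∸ t) * L lam t t
    L-suc λ₁≥1 {j} {t} t<j = begin
      (L lam j t + leavesList (replicate (Λ′ ∸ 1) (T lam t))) + ℓ
        ≡⟨ cong (λ x → L lam j t + x + ℓ) (leavesList-replicate (Λ′ ∸ 1) (T lam t)) ⟩
      (L lam j t + (Λ′ ∸ 1) * ℓ) + ℓ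
        ≡⟨ +-assoc (L lam j t) _ ℓ ⟩
      L lam j t + ((Λ′ ∸ 1) * ℓ + ℓ)
        ≡⟨ cong (λ n → L lam j t + n) (+-comm _ ℓ) ⟩
      L lam j t + (1 + (Λ′ ∸ 1)) * ℓ
        ≡⟨ cong (λ c → L lam j t + c * ℓ) (m+[n∸m]≡n (Lam-pos λ₁≥1 (m<n⇒0<n∸m t<j))) ⟩
      L lam j t + Λ′ * ℓ  ∎
      where
      open ≡-Reasoning
      Λ′ = Lam lam (j ∸ t)
      ℓ  = L lam t t

  module _ (lam : ℕ → ℕ) (k : ℕ) (k≥1 : 1 ≤ k) (λ₁≥1 : 1 ≤ lam 1)
           (lam-vanishing : ∀ i → k < i → lam i ≡ 0) where

    private
      A : ℕ → ℕ
      A = a lam k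

      M : ℕ
      M = Lam lam k ∸ 1

    LeafRecurrence : ℕ → Set
    LeafRecurrence t = L lam t t * M + A t ≡ A (suc t)

    -- R(j,t) above; summing up to k + j rather than k keeps all weights λ_i with i ≤ j - t.
    interpolant : ℕ → ℕ → ℕ
    interpolant j t = sum1 (k + j) (λ i → lam i * A (t ⊓ (suc j ∸ i)))

    interpolant-zero : ∀ j → interpolant j 0 ≡ Lam lam k
    interpolant-zero j = begin
      sum1 (k + j) (λ i → lam i * 1)  ≡⟨ sum1-vanishing k (λ i k<i → cong (_* 1) (lam-vanishing i k<i)) j ⟩
      sum1 k (λ i → lam i * 1)        ≡⟨ sum1-*-const lam k 1 ⟩
      Lam lam k * 1                   ≡⟨ *-identityʳ _ ⟩
      Lam lam k                       ∎
      where open ≡-Reasoning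

    interpolant-diag : ∀ j → interpolant j j ≡ A (suc j)
    interpolant-diag j = begin
      sum1 (k + j) (λ i → lam i * A (j ⊓ (suc j ∸ i)))
        ≡⟨ sum1-vanishing k (λ i k<i → cong (_* A (j ⊓ (suc j ∸ i))) (lam-vanishing i k<i)) j ⟩
      sum1 k (λ i → lam i * A (j ⊓ (suc j ∸ i)))
        ≡⟨ sum1-cong k (λ i → cong (λ x → lam (suc i) * A x) (m≥n⇒m⊓n≡n (m∸n≤m j i))) ⟩
      sum1 k (λ i → lam i * A (j ∸ (i ∸ 1)))
        ≡⟨ a-suc lam k j ⟨
      A (suc j)  ∎
      where open ≡-Reasoning

    interpolant-suc : ∀ {j t} D → t ≤ j → D + A t ≡ A (suc t)
      → interpolant j (suc t) ≡ interpolant j t + Lam lam (j ∸ t) * D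
    interpolant-suc {j} {t} D t≤j D+At≡At+1 =
      sum1-*-+-const-prefix lam (k + j) (j ∸ t) D (≤-trans (m∸n≤m j t) (m≤n+m j k)) grows stays
      where
      grows : ∀ i → i ≤ j ∸ t → A (suc t ⊓ (suc j ∸ i)) ≡ A (t ⊓ (suc j ∸ i)) + D
      grows i i≤j∸t = begin
        A (suc t ⊓ (suc j ∸ i))  ≡⟨ cong A (m≤n⇒m⊓n≡m t<1+j∸i) ⟩
        A (suc t)                ≡⟨ D+At≡At+1 ⟨
        D + A t                  ≡⟨ +-comm D (A t) ⟩
        A t + D                  ≡⟨ cong (λ x → A x + D) (m≤n⇒m⊓n≡m (<⇒≤ t<1+j∸i)) ⟨
        A (t ⊓ (suc j ∸ i)) + D  ∎
        where
        open ≡-Reasoning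
        t<1+j∸i = m≤n∸o⇒1+o≤1+n∸m {i} {j} {t} t≤j i≤j∸t

      stays : ∀ i → j ∸ t < i → A (suc t ⊓ (suc j ∸ i)) ≡ A (t ⊓ (suc j ∸ i))
      stays i j∸t<i = trans (cong A (m≥n⇒m⊓n≡n (m≤n⇒m≤1+n 1+j∸i≤t)))
                            (sym (cong A (m≥n⇒m⊓n≡n 1+j∸i≤t)))
        where 1+j∸i≤t = n∸o<m⇒1+n∸m≤o {i} {j} {t} j∸t<i

    L-interpolant : ∀ j → (∀ {t} → t < j → LeafRecurrence t)
      → ∀ t → t ≤ j → L lam j t * M + A t ≡ interpolant j t
    L-interpolant j rec zero _ = begin
      1 * M + 1        ≡⟨ cong (_+ 1) (*-identityˡ M) ⟩
      M + 1            ≡⟨ m∸n+n≡m (Lam-pos lam λ₁≥1 k≥1) ⟩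
      Lam lam k        ≡⟨ interpolant-zero j ⟨
      interpolant j 0  ∎
      where open ≡-Reasoning
    L-interpolant j rec (suc t) t<j = begin
      L lam j (suc t) * M + A (suc t)
        ≡⟨ cong (λ n → L lam j (suc t) * M + n) (sym (rec t<j)) ⟩
      L lam j (suc t) * M + (ℓ * M + A t)
        ≡⟨ gather (L lam j (suc t)) ℓ M (A t) ⟩
      (L lam j (suc t) + ℓ) * M + A t
        ≡⟨ cong (λ x → x * M + A t) (L-suc lam λ₁≥1 t<j) ⟩
      (L lam j t + Λ′ * ℓ) * M + A t
        ≡⟨ spread (L lam j t) Λ′ ℓ M (A t) ⟩
      (L lam j t * M + A t) + Λ′ * (ℓ * M)
        ≡⟨ cong (_+ Λ′ * (ℓ * M)) (L-interpolant j rec t (<⇒≤ t<j)) ⟩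
      interpolant j t + Λ′ * (ℓ * M)
        ≡⟨ interpolant-suc (ℓ * M) (<⇒≤ t<j) (rec t<j) ⟨
      interpolant j (suc t)  ∎
      where
      open ≡-Reasoning
      ℓ  = L lam t t
      Λ′ = Lam lam (j ∸ t)
      gather : ∀ x y m z → x * m + (y * m + z) ≡ (x + y) * m + z
      gather = solve-∀
      spread : ∀ x c y m z → (x + c * y) * m + z ≡ (x * m + z) + c * (y * m)
      spread = solve-∀

    leafRecurrence : ∀ j → LeafRecurrence j
    leafRecurrence = <-rec LeafRecurrence λ j rec →
      trans (L-interpolant j rec j ≤-refl) (interpolant-diag j)

  +[m+n]-+n≡+m : ∀ m n → + (m + n) ℤ.- + n ≡ + m
  +[m+n]-+n≡+m m n = begin
    + (m + n) ℤ.- + n  ≡⟨ [+m]-[+n]≡m⊖n (m + n) n ⟩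
    (m + n) ⊖ n        ≡⟨ ⊖-≥ (m≤n+m n m) ⟩
    + (m + n ∸ n)      ≡⟨ cong +_ (m+n∸n≡m m n) ⟩
    + m                ∎
    where open ≡-Reasoning

  ℤ-*-pred : ∀ x {d m n} → 1 ≤ d → x * (d ∸ 1) + m ≡ n → + x ℤ.* (+ d ℤ.- + 1) ≡ + n ℤ.- + m
  ℤ-*-pred x {d} {m} {n} d≥1 x*[d∸1]+m≡n = begin
    + x ℤ.* (+ d ℤ.- + 1)              ≡⟨ cong (λ e → + x ℤ.* (+ e ℤ.- + 1)) (m∸n+n≡m d≥1) ⟨
    + x ℤ.* (+ (d ∸ 1 + 1) ℤ.- + 1)    ≡⟨ cong (+ x ℤ.*_) (+[m+n]-+n≡+m (d ∸ 1) 1) ⟩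
    + x ℤ.* + (d ∸ 1)                  ≡⟨ pos-* x (d ∸ 1) ⟨
    + (x * (d ∸ 1))                    ≡⟨ +[m+n]-+n≡+m (x * (d ∸ 1)) m ⟨
    + (x * (d ∸ 1) + m) ℤ.- + m        ≡⟨ cong (λ e → + e ℤ.- + m) x*[d∸1]+m≡n ⟩
    + n ℤ.- + m                        ∎
    where open ≡-Reasoning

open LeafCount using (Lam-pos; leafRecurrence; ℤ-*-pred)
open import Data.Integer using (+_; _-_; _*_)

lemma4p10 : (lam : ℕ → ℕ) (k : ℕ) → 1 ≤ k → 1 ≤ lam 1 → 1 ≤ lam k
    → (∀ i → k < i → lam i ≡ 0) → (k ≡ 1 → 2 ≤ lam 1)
    → (j : ℕ)
    → (+ L lam j j) * (+ Lam lam k - + 1) ≡ + a lam k (Data.Nat.suc j) - + a lam k j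
lemma4p10 lam k k≥1 λ₁≥1 _ lam-vanishing _ j =
  ℤ-*-pred (L lam j j) (Lam-pos lam λ₁≥1 k≥1) (leafRecurrence lam k k≥1 λ₁≥1 lam-vanishing j)
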